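{- Let $a,b$ be numbers, not both zero, and let $(G_k)_{k\in\mathbb Z}$ be the gibonacci sequence with $G_0=a$, $G_1=b$, $G_k=G_{k-1}+G_{k-2}$ for all integers $k$. Then for all integers $n$ and $t$, \begin{align*} 44\sum_{j = 1}^n G_{j + t}^5 &= - \left( G_{n + t + 3}^5 - G_{t + 3}^5 \right) + 7\left( G_{n + t + 2}^5 - G_{t + 2}^5 \right) + 47\left( G_{n + t + 1}^5 - G_{t + 1}^5 \right)\\ &\quad+ 31\left( G_{n + t}^5 - G_t^5 \right) - 9\left( G_{n + t - 1}^5 - G_{t - 1}^5 \right) - \left( G_{n + t - 2}^5 - G_{t - 2}^5 \right) \end{align*} and \begin{align*} 44\sum_{j = 1}^n (-1)^{j - 1}G_{j + t}^5 &= - \left( (-1)^{n + 1}G_{n + t + 3}^5 + G_{t + 3}^5 \right) + 9\left( (-1)^{n + 1}G_{n + t + 2}^5 + G_{t + 2}^5 \right)\\ &\quad + 31\left( (-1)^{n + 1}G_{n + t + 1}^5 + G_{t + 1}^5 \right)- 47\left( (-1)^{n + 1}G_{n + t}^5 + G_t^5 \right)\\ &\quad + 7\left( (-1)^{n + 1}G_{n + t - 1}^5 + G_{t - 1}^5 \right) + \left( (-1)^{n + 1}G_{n + t - 2}^5 + G_{t - 2}^5 \right). \end{align*}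
   Context: The gibonacci sequence is extended to negative indices via $G_{ -k}=G_{ -(k-2)}-G_{ -(k-1)}$, so the recurrence $G_k=G_{k-1}+G_{k-2}$ holds for all $k\in\mathbb Z$. Summation convention: $\sum_{j=1}^0 (\cdot)=0$, and for $n<0$, $\sum_{j=1}^n a_j := -\sum_{j=n+1}^{0} a_j$. -}

module Defs where

open import Level using (Level)
open import Algebra.Bundles using (CommutativeRing)
open import Data.Nat as ℕ using (ℕ; zero; suc)
open import Data.Integer as ℤ using (ℤ; +_; -[1+_])

-- Everything is parametrised by a commutative ring R (the "numbers").
module Gib {c ℓ : Level} (R : CommutativeRing c ℓ) where
  open CommutativeRing R

  pow : Carrier → ℕ → Carrier
  pow x zero = 1#
  pow x (suc n) = x * pow x n

  nat : ℕ → Carrier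
  nat zero = 0#
  nat (suc n) = 1# + nat n

  -- (-1)^n for an integer n (depends only on the parity of n)
  signℕ : ℕ → Carrier
  signℕ zero = 1#
  signℕ (suc n) = - signℕ n

  sign : ℤ → Carrier
  sign n = signℕ ℤ.∣ n ∣

  module _ (a b : Carrier) where
    Gpos : ℕ → Carrier
    Gpos zero = a
    Gpos (suc zero) = b
    Gpos (suc (suc k)) = Gpos (suc k) + Gpos k

    -- Gneg k = G_{-k}, via G_{-k} = G_{-(k-2)} - G_{-(k-1)}
    Gneg : ℕ → Carrier
    Gneg zero = a
    Gneg (suc zero) = b - a
    Gneg (suc (suc k)) = Gneg k - Gneg (suc k)

    G : ℤ → Carrier
    G (+ n) = Gpos n
    G -[1+ n ] = Gneg (suc n)

  sumPos : (ℤ → Carrier) → ℕ → Carrier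
  sumPos f zero = 0#
  sumPos f (suc m) = sumPos f m + f (+ suc m)

  sumNeg : (ℤ → Carrier) → ℕ → Carrier
  sumNeg f zero = f (+ 0)
  sumNeg f (suc m) = sumNeg f m + f (ℤ.- (+ suc m))

  -- Σ_{j=1}^{n} f(j) for n : ℤ, with the convention
  -- Σ_{j=1}^{n} a_j = - Σ_{j=n+1}^{0} a_j for n < 0.
  -- For n = -[1+ m ] = -(m+1), the range n+1..0 is -m..0.
  sum1to : (ℤ → Carrier) → ℤ → Carrier
  sum1to f (+ m) = sumPos f m
  sum1to f -[1+ m ] = - sumNeg f m

-- Write Φ₁ and Φ₂ for the linear forms in G^5 on the two right-hand sides, so that these are
-- Φ₁(n+t) - Φ₁(t) and (-1)^(n+1) Φ₂(n+t) + Φ₂(t).  Both identities telescope once we know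
-- Φ₁(m) - Φ₁(m-1) = 44 G_m^5 and Φ₂(m) + Φ₂(m-1) = 44 G_m^5 for every m.  A solution of the
-- recurrence is the gibonacci sequence of any two consecutive values, so restarting at u = G_{m-3},
-- v = G_{m-2} turns each of these into the case m = 3, which is a polynomial identity in u and v.
module Submission where

open import Level using (Level)
open import Algebra.Bundles using (CommutativeRing)
open import Algebra.Solver.Ring.AlmostCommutativeRing
  using (fromCommutativeRing; _-Raw-AlmostCommutative⟶_)
open import Data.Integer as ℤ using (ℤ; +_; -[1+_]; _⊖_)
import Data.Integer.Properties as ℤP
open import Data.Integer.Tactic.RingSolver using (solve-∀)
open import Data.Maybe using (Maybe; just; nothing)
open import Data.Nat as ℕ using (ℕ; zero; suc)
import Data.Nat.Properties as ℕP
open import Data.Product using (_×_; _,_)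
open import Relation.Binary.PropositionalEquality as ≡ using (_≡_)
open import Relation.Nullary using (¬_; yes; no)
open import Defs

-- The ring solver needs coefficients with decidable equality; ℤ provides them through its
-- canonical map into R.
module IntegerCoefficients {c ℓ : Level} (R : CommutativeRing c ℓ) where
  open CommutativeRing R
  open Gib R using (nat)
  open import Algebra.Properties.Ring ring
    using (-‿involutive; -‿distribˡ-*; -‿distribʳ-*; -‿+-comm; -0#≈0#)
  open import Algebra.Properties.CommutativeSemigroup +-commutativeSemigroup using (interchange)
  open import Algebra.Properties.Semiring.Mult semiring
    using (×-homo-+; ×1-homo-*) renaming (_×_ to _·_)
  open import Relation.Binary.Reasoning.Setoid setoid

  nat≈·1# : ∀ n → nat n ≈ n · 1#
  nat≈·1# zero = refl
  nat≈·1# (suc n) = +-congˡ (nat≈·1# n)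

  nat-+ : ∀ m n → nat (m ℕ.+ n) ≈ nat m + nat n
  nat-+ m n = begin
    nat (m ℕ.+ n)          ≈⟨ nat≈·1# (m ℕ.+ n) ⟩
    (m ℕ.+ n) · 1#         ≈⟨ ×-homo-+ 1# m n ⟩
    m · 1# + n · 1#        ≈⟨ +-cong (nat≈·1# m) (nat≈·1# n) ⟨
    nat m + nat n          ∎

  nat-* : ∀ m n → nat (m ℕ.* n) ≈ nat m * nat n
  nat-* m n = begin
    nat (m ℕ.* n)          ≈⟨ nat≈·1# (m ℕ.* n) ⟩
    (m ℕ.* n) · 1#         ≈⟨ ×1-homo-* m n ⟩
    (m · 1#) * (n · 1#)    ≈⟨ *-cong (nat≈·1# m) (nat≈·1# n) ⟨
    nat m * nat n          ∎

  ⟦_⟧ : ℤ → Carrier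
  ⟦ + n ⟧ = nat n
  ⟦ -[1+ n ] ⟧ = - nat (suc n)

  ⟦-⟧ : ∀ i → ⟦ ℤ.- i ⟧ ≈ - ⟦ i ⟧
  ⟦-⟧ (+ zero) = sym -0#≈0#
  ⟦-⟧ (+ suc n) = refl
  ⟦-⟧ -[1+ n ] = sym (-‿involutive _)

  ⟦⊖⟧ : ∀ m n → ⟦ m ⊖ n ⟧ ≈ nat m - nat n
  ⟦⊖⟧ zero zero = trans (sym (+-identityʳ 0#)) (+-congˡ (sym -0#≈0#))
  ⟦⊖⟧ zero (suc n) = sym (+-identityˡ _)
  ⟦⊖⟧ (suc m) zero = trans (sym (+-identityʳ _)) (+-congˡ (sym -0#≈0#))
  ⟦⊖⟧ (suc m) (suc n) = begin
    ⟦ suc m ⊖ suc n ⟧                ≡⟨ ≡.cong ⟦_⟧ (ℤP.[1+m]⊖[1+n]≡m⊖n m n) ⟩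
    ⟦ m ⊖ n ⟧                        ≈⟨ ⟦⊖⟧ m n ⟩
    nat m - nat n                    ≈⟨ +-identityˡ _ ⟨
    0# + (nat m - nat n)             ≈⟨ +-congʳ (-‿inverseʳ 1#) ⟨
    (1# - 1#) + (nat m - nat n)      ≈⟨ interchange 1# (- 1#) (nat m) (- nat n) ⟩
    (1# + nat m) + (- 1# - nat n)    ≈⟨ +-congˡ (-‿+-comm 1# (nat n)) ⟩
    (1# + nat m) - (1# + nat n)      ∎

  ⟦+⟧ : ∀ i j → ⟦ i ℤ.+ j ⟧ ≈ ⟦ i ⟧ + ⟦ j ⟧
  ⟦+⟧ (+ m) (+ n) = nat-+ m n
  ⟦+⟧ (+ m) -[1+ n ] = ⟦⊖⟧ m (suc n)
  ⟦+⟧ -[1+ m ] (+ n) = trans (⟦⊖⟧ n (suc m)) (+-comm _ _)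
  ⟦+⟧ -[1+ m ] -[1+ n ] = begin
    - nat (suc (suc (m ℕ.+ n)))      ≡⟨ ≡.cong (λ k → - nat (suc k)) (ℕP.+-suc m n) ⟨
    - nat (suc m ℕ.+ suc n)          ≈⟨ -‿cong (nat-+ (suc m) (suc n)) ⟩
    - (nat (suc m) + nat (suc n))    ≈⟨ -‿+-comm _ _ ⟨
    - nat (suc m) + - nat (suc n)    ∎

  ⟦+*+⟧ : ∀ m n → ⟦ + m ℤ.* + n ⟧ ≈ nat m * nat n
  ⟦+*+⟧ m n = trans (reflexive (≡.cong ⟦_⟧ (≡.sym (ℤP.pos-* m n)))) (nat-* m n)

  ⟦*⟧ : ∀ i j → ⟦ i ℤ.* j ⟧ ≈ ⟦ i ⟧ * ⟦ j ⟧
  ⟦*⟧ (+ m) (+ n) = ⟦+*+⟧ m n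
  ⟦*⟧ (+ m) -[1+ n ] = begin
    ⟦ + m ℤ.* ℤ.- + suc n ⟧            ≡⟨ ≡.cong ⟦_⟧ (ℤP.neg-distribʳ-* (+ m) (+ suc n)) ⟨
    ⟦ ℤ.- (+ m ℤ.* + suc n) ⟧          ≈⟨ ⟦-⟧ (+ m ℤ.* + suc n) ⟩
    - ⟦ + m ℤ.* + suc n ⟧              ≈⟨ -‿cong (⟦+*+⟧ m (suc n)) ⟩
    - (nat m * nat (suc n))            ≈⟨ -‿distribʳ-* _ _ ⟩
    nat m * - nat (suc n)              ∎
  ⟦*⟧ -[1+ m ] (+ n) = begin
    ⟦ ℤ.- + suc m ℤ.* + n ⟧            ≡⟨ ≡.cong ⟦_⟧ (ℤP.neg-distribˡ-* (+ suc m) (+ n)) ⟨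
    ⟦ ℤ.- (+ suc m ℤ.* + n) ⟧          ≈⟨ ⟦-⟧ (+ suc m ℤ.* + n) ⟩
    - ⟦ + suc m ℤ.* + n ⟧              ≈⟨ -‿cong (⟦+*+⟧ (suc m) n) ⟩
    - (nat (suc m) * nat n)            ≈⟨ -‿distribˡ-* _ _ ⟩
    - nat (suc m) * nat n              ∎
  ⟦*⟧ -[1+ m ] -[1+ n ] = begin
    ⟦ + suc m ℤ.* + suc n ⟧            ≈⟨ ⟦+*+⟧ (suc m) (suc n) ⟩
    nat (suc m) * nat (suc n)          ≈⟨ -‿involutive _ ⟨
    - - (nat (suc m) * nat (suc n))    ≈⟨ -‿cong (-‿distribʳ-* _ _) ⟩
    - (nat (suc m) * - nat (suc n))    ≈⟨ -‿distribˡ-* _ _ ⟩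
    - nat (suc m) * - nat (suc n)      ∎

  ℤ⟶R : ℤ.+-*-rawRing -Raw-AlmostCommutative⟶ fromCommutativeRing R
  ℤ⟶R = record
    { ⟦_⟧ = ⟦_⟧ ; +-homo = ⟦+⟧ ; *-homo = ⟦*⟧ ; -‿homo = ⟦-⟧
    ; 0-homo = refl ; 1-homo = +-identityʳ 1# }

  ⟦≟⟧ : ∀ i j → Maybe (⟦ i ⟧ ≈ ⟦ j ⟧)
  ⟦≟⟧ i j with i ℤ.≟ j
  ... | yes ≡.refl = just refl
  ... | no _ = nothing

  open import Algebra.Solver.Ring ℤ.+-*-rawRing (fromCommutativeRing R) ℤ⟶R ⟦≟⟧ public
    using (solve; _:=_; Polynomial; con; _:+_; _:-_; :-_; _:*_; _:^_)

m≡m-3+3 : ∀ m → m ≡ m ℤ.- + 3 ℤ.+ + 3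
m≡m-3+3 = solve-∀

m-1≡m-3+2 : ∀ m → m ℤ.- + 1 ≡ m ℤ.- + 3 ℤ.+ + 2
m-1≡m-3+2 = solve-∀

n-1+t≡n+t-1 : ∀ n t → n ℤ.- + 1 ℤ.+ t ≡ n ℤ.+ t ℤ.- + 1
n-1+t≡n+t-1 = solve-∀

n+1≡n-1+2 : ∀ n → n ℤ.+ + 1 ≡ n ℤ.- + 1 ℤ.+ + 2
n+1≡n-1+2 = solve-∀

module FifthPowerSums {c ℓ : Level} (R : CommutativeRing c ℓ) where
  open CommutativeRing R
  open Gib R
  open IntegerCoefficients R using (solve; _:=_; Polynomial; con; _:+_; _:-_; :-_; _:*_; _:^_)
  open import Algebra.Properties.Ring ring using (-‿involutive; -‿+-comm; -‿distribʳ-*; -1*x≈-x)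
  open import Relation.Binary.Reasoning.Setoid setoid

  pow-cong : ∀ {x y} n → x ≈ y → pow x n ≈ pow y n
  pow-cong zero _ = refl
  pow-cong (suc n) x≈y = *-cong x≈y (pow-cong n x≈y)

  x≈y+[x-y] : ∀ x y → x ≈ y + (x - y)
  x≈y+[x-y] = solve 2 (λ x y → x := y :+ (x :- y)) refl

  x≈y+z⇒y≈x-z : ∀ {x y z} → x ≈ y + z → y ≈ x - z
  x≈y+z⇒y≈x-z {x} {y} {z} x≈y+z = begin
    y              ≈⟨ solve 2 (λ y z → y := (y :+ z) :- z) refl y z ⟩
    (y + z) - z    ≈⟨ +-congʳ x≈y+z ⟨
    x - z          ∎

  sign-suc : ∀ i → sign (i ℤ.+ + 1) ≈ - sign i
  sign-suc (+ m) = reflexive (≡.cong signℕ (ℕP.+-comm m 1))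
  sign-suc -[1+ zero ] = sym (-‿involutive _)
  sign-suc -[1+ suc m ] = sym (-‿involutive _)

  sign-+2 : ∀ i → sign (i ℤ.+ + 2) ≈ sign i
  sign-+2 i = begin
    sign (i ℤ.+ + 2)              ≡⟨ ≡.cong sign (ℤP.+-assoc i (+ 1) (+ 1)) ⟨
    sign (i ℤ.+ + 1 ℤ.+ + 1)      ≈⟨ sign-suc (i ℤ.+ + 1) ⟩
    - sign (i ℤ.+ + 1)            ≈⟨ -‿cong (sign-suc i) ⟩
    - - sign i                    ≈⟨ -‿involutive _ ⟩
    sign i                        ∎

  telescope : (k : Carrier) (f D : ℤ → Carrier) → D (+ 0) ≈ 0# →
              (∀ n → D n ≈ D (n ℤ.- + 1) + k * f n) →
              ∀ n → k * sum1to f n ≈ D n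
  telescope k f D D0≈0 step = go
    where
    negative : ∀ m → D -[1+ m ] ≈ - (k * sumNeg f m)
    negative zero = begin
      D -[1+ 0 ]                     ≈⟨ x≈y+z⇒y≈x-z (step (+ 0)) ⟩
      D (+ 0) - k * f (+ 0)          ≈⟨ +-congʳ D0≈0 ⟩
      0# - k * f (+ 0)               ≈⟨ +-identityˡ _ ⟩
      - (k * f (+ 0))                ∎
    negative (suc m) = begin
      D -[1+ suc m ]                             ≡⟨ ≡.cong (λ i → D -[1+ suc i ]) (ℕP.+-identityʳ m) ⟨
      D (-[1+ m ] ℤ.- + 1)                       ≈⟨ x≈y+z⇒y≈x-z (step -[1+ m ]) ⟩
      D -[1+ m ] - k * f -[1+ m ]                ≈⟨ +-congʳ (negative m) ⟩
      - (k * sumNeg f m) - k * f -[1+ m ]        ≈⟨ -‿+-comm _ _ ⟩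
      - (k * sumNeg f m + k * f -[1+ m ])        ≈⟨ -‿cong (distribˡ k _ _) ⟨
      - (k * (sumNeg f m + f -[1+ m ]))          ∎
    go : ∀ n → k * sum1to f n ≈ D n
    go (+ zero) = trans (zeroʳ k) (sym D0≈0)
    go (+ suc m) = begin
      k * (sumPos f m + f (+ suc m))        ≈⟨ distribˡ k _ _ ⟩
      k * sumPos f m + k * f (+ suc m)      ≈⟨ +-congʳ (go (+ m)) ⟩
      D (+ m) + k * f (+ suc m)             ≈⟨ step (+ suc m) ⟨
      D (+ suc m)                           ∎
    go -[1+ m ] = trans (sym (-‿distribʳ-* k _)) (sym (negative m))

  G-rec : ∀ a b k → G a b (k ℤ.+ + 2) ≈ G a b (k ℤ.+ + 1) + G a b k
  G-rec a b (+ n) rewrite ℕP.+-comm n 2 | ℕP.+-comm n 1 = refl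
  G-rec a b -[1+ zero ] = x≈y+[x-y] b a
  G-rec a b -[1+ suc zero ] = x≈y+[x-y] a (b - a)
  G-rec a b -[1+ suc (suc n) ] = x≈y+[x-y] _ _

  module _ (x : ℤ → Carrier) (x-rec : ∀ k → x (k ℤ.+ + 2) ≈ x (k ℤ.+ + 1) + x k) where

    x-rec⁻ : ∀ k → x k ≈ x (k ℤ.+ + 2) - x (k ℤ.+ + 1)
    x-rec⁻ k = x≈y+z⇒y≈x-z (trans (x-rec k) (+-comm _ _))

    recurrence⇒≈G : ∀ k → x k ≈ G (x (+ 0)) (x (+ 1)) k
    recurrence⇒≈G (+ zero) = refl
    recurrence⇒≈G (+ suc zero) = refl
    recurrence⇒≈G (+ suc (suc n)) = begin
      x (+ (2 ℕ.+ n))                  ≡⟨ ≡.cong (λ i → x (+ i)) (ℕP.+-comm 2 n) ⟩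
      x (+ n ℤ.+ + 2)                  ≈⟨ x-rec (+ n) ⟩
      x (+ n ℤ.+ + 1) + x (+ n)        ≡⟨ ≡.cong (λ i → x (+ i) + x (+ n)) (ℕP.+-comm n 1) ⟩
      x (+ suc n) + x (+ n)            ≈⟨ +-cong (recurrence⇒≈G (+ suc n)) (recurrence⇒≈G (+ n)) ⟩
      G (x (+ 0)) (x (+ 1)) (+ suc (suc n)) ∎
    recurrence⇒≈G -[1+ zero ] = x-rec⁻ -[1+ 0 ]
    recurrence⇒≈G -[1+ suc zero ] = trans (x-rec⁻ -[1+ 1 ]) (+-congˡ (-‿cong (recurrence⇒≈G -[1+ 0 ])))
    recurrence⇒≈G -[1+ suc (suc n) ] =
      trans (x-rec⁻ -[1+ suc (suc n) ])
            (+-cong (recurrence⇒≈G -[1+ n ]) (-‿cong (recurrence⇒≈G -[1+ suc n ])))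

  Φ₁ Φ₂ : (ℤ → Carrier) → ℤ → Carrier
  Φ₁ g m = - g (m ℤ.+ + 3) + nat 7 * g (m ℤ.+ + 2) + nat 47 * g (m ℤ.+ + 1) + nat 31 * g m
           - nat 9 * g (m ℤ.- + 1) - g (m ℤ.- + 2)
  Φ₂ g m = - g (m ℤ.+ + 3) + nat 9 * g (m ℤ.+ + 2) + nat 31 * g (m ℤ.+ + 1) - nat 47 * g m
           + nat 7 * g (m ℤ.- + 1) + g (m ℤ.- + 2)

  module _ (g : ℤ → Carrier) (m : ℤ) (h : ℤ → Carrier) (m′ : ℤ)
           (g≈h : ∀ i → g (m ℤ.+ i) ≈ h (m′ ℤ.+ i)) where

    centre-≈ : g m ≈ h m′
    centre-≈ = begin
      g m            ≡⟨ ≡.cong g (ℤP.+-identityʳ m) ⟨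
      g (m ℤ.+ + 0)  ≈⟨ g≈h (+ 0) ⟩
      h (m′ ℤ.+ + 0) ≡⟨ ≡.cong h (ℤP.+-identityʳ m′) ⟩
      h m′           ∎

    Φ₁-cong : Φ₁ g m ≈ Φ₁ h m′
    Φ₁-cong = +-cong (+-cong (+-cong (+-cong (+-cong (-‿cong (g≈h (+ 3)))
      (*-congˡ (g≈h (+ 2)))) (*-congˡ (g≈h (+ 1)))) (*-congˡ centre-≈))
      (-‿cong (*-congˡ (g≈h -[1+ 0 ])))) (-‿cong (g≈h -[1+ 1 ]))

    Φ₂-cong : Φ₂ g m ≈ Φ₂ h m′
    Φ₂-cong = +-cong (+-cong (+-cong (+-cong (+-cong (-‿cong (g≈h (+ 3)))
      (*-congˡ (g≈h (+ 2)))) (*-congˡ (g≈h (+ 1)))) (-‿cong (*-congˡ centre-≈)))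
      (*-congˡ (g≈h -[1+ 0 ]))) (g≈h -[1+ 1 ])

  Φ₁-difference : ∀ g m t → Φ₁ g m - Φ₁ g t ≈
    - (g (m ℤ.+ + 3) - g (t ℤ.+ + 3)) + nat 7 * (g (m ℤ.+ + 2) - g (t ℤ.+ + 2))
    + nat 47 * (g (m ℤ.+ + 1) - g (t ℤ.+ + 1)) + nat 31 * (g m - g t)
    - nat 9 * (g (m ℤ.- + 1) - g (t ℤ.- + 1)) - (g (m ℤ.- + 2) - g (t ℤ.- + 2))
  Φ₁-difference g m t = solve 12 (λ x₃ x₂ x₁ x₀ x₋₁ x₋₂ y₃ y₂ y₁ y₀ y₋₁ y₋₂ →
      let φ = λ z₃ z₂ z₁ z₀ z₋₁ z₋₂ → :- z₃ :+ con (+ 7) :* z₂ :+ con (+ 47) :* z₁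
                                       :+ con (+ 31) :* z₀ :- con (+ 9) :* z₋₁ :- z₋₂
      in φ x₃ x₂ x₁ x₀ x₋₁ x₋₂ :- φ y₃ y₂ y₁ y₀ y₋₁ y₋₂
      := :- (x₃ :- y₃) :+ con (+ 7) :* (x₂ :- y₂) :+ con (+ 47) :* (x₁ :- y₁)
         :+ con (+ 31) :* (x₀ :- y₀) :- con (+ 9) :* (x₋₁ :- y₋₁) :- (x₋₂ :- y₋₂))
    refl (g (m ℤ.+ + 3)) (g (m ℤ.+ + 2)) (g (m ℤ.+ + 1)) (g m) (g (m ℤ.- + 1)) (g (m ℤ.- + 2))
         (g (t ℤ.+ + 3)) (g (t ℤ.+ + 2)) (g (t ℤ.+ + 1)) (g t) (g (t ℤ.- + 1)) (g (t ℤ.- + 2))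

  Φ₂-combination : ∀ g s m t → s * Φ₂ g m + Φ₂ g t ≈
    - (s * g (m ℤ.+ + 3) + g (t ℤ.+ + 3)) + nat 9 * (s * g (m ℤ.+ + 2) + g (t ℤ.+ + 2))
    + nat 31 * (s * g (m ℤ.+ + 1) + g (t ℤ.+ + 1)) - nat 47 * (s * g m + g t)
    + nat 7 * (s * g (m ℤ.- + 1) + g (t ℤ.- + 1)) + (s * g (m ℤ.- + 2) + g (t ℤ.- + 2))
  Φ₂-combination g s m t = solve 13 (λ s x₃ x₂ x₁ x₀ x₋₁ x₋₂ y₃ y₂ y₁ y₀ y₋₁ y₋₂ →
      let φ = λ z₃ z₂ z₁ z₀ z₋₁ z₋₂ → :- z₃ :+ con (+ 9) :* z₂ :+ con (+ 31) :* z₁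
                                       :- con (+ 47) :* z₀ :+ con (+ 7) :* z₋₁ :+ z₋₂
      in s :* φ x₃ x₂ x₁ x₀ x₋₁ x₋₂ :+ φ y₃ y₂ y₁ y₀ y₋₁ y₋₂
      := :- (s :* x₃ :+ y₃) :+ con (+ 9) :* (s :* x₂ :+ y₂) :+ con (+ 31) :* (s :* x₁ :+ y₁)
         :- con (+ 47) :* (s :* x₀ :+ y₀) :+ con (+ 7) :* (s :* x₋₁ :+ y₋₁) :+ (s :* x₋₂ :+ y₋₂))
    refl s (g (m ℤ.+ + 3)) (g (m ℤ.+ + 2)) (g (m ℤ.+ + 1)) (g m) (g (m ℤ.- + 1)) (g (m ℤ.- + 2))
           (g (t ℤ.+ + 3)) (g (t ℤ.+ + 2)) (g (t ℤ.+ + 1)) (g t) (g (t ℤ.- + 1)) (g (t ℤ.- + 2))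

  gibonacci : ∀ {n} → Polynomial n → Polynomial n → ℕ → Polynomial n
  gibonacci u v zero = u
  gibonacci u v (suc zero) = v
  gibonacci u v (suc (suc k)) = gibonacci u v (suc k) :+ gibonacci u v k

  G⁵ : Carrier → Carrier → ℤ → Carrier
  G⁵ u v k = pow (G u v k) 5

  Φ₁-step-at-3 : ∀ u v → Φ₁ (G⁵ u v) (+ 3) ≈ Φ₁ (G⁵ u v) (+ 2) + nat 44 * G⁵ u v (+ 3)
  Φ₁-step-at-3 = solve 2 (λ u v → let p = λ k → gibonacci u v k :^ 5 in
      :- p 6 :+ con (+ 7) :* p 5 :+ con (+ 47) :* p 4 :+ con (+ 31) :* p 3
        :- con (+ 9) :* p 2 :- p 1
    := :- p 5 :+ con (+ 7) :* p 4 :+ con (+ 47) :* p 3 :+ con (+ 31) :* p 2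
        :- con (+ 9) :* p 1 :- p 0 :+ con (+ 44) :* p 3) refl

  Φ₂-step-at-3 : ∀ u v → Φ₂ (G⁵ u v) (+ 3) + Φ₂ (G⁵ u v) (+ 2) ≈ nat 44 * G⁵ u v (+ 3)
  Φ₂-step-at-3 = solve 2 (λ u v → let p = λ k → gibonacci u v k :^ 5 in
      :- p 6 :+ con (+ 9) :* p 5 :+ con (+ 31) :* p 4 :- con (+ 47) :* p 3
        :+ con (+ 7) :* p 2 :+ p 1
      :+ (:- p 5 :+ con (+ 9) :* p 4 :+ con (+ 31) :* p 3 :- con (+ 47) :* p 2
        :+ con (+ 7) :* p 1 :+ p 0)
    := con (+ 44) :* p 3) refl

  module Sequence (a b : Carrier) where

    g : ℤ → Carrier
    g = G⁵ a b

    G-shift : ∀ j k → G a b (j ℤ.+ k) ≈ G (G a b (j ℤ.+ + 0)) (G a b (j ℤ.+ + 1)) k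
    G-shift j = recurrence⇒≈G (λ k → G a b (j ℤ.+ k)) shifted-rec
      where
      shifted-rec : ∀ k → G a b (j ℤ.+ (k ℤ.+ + 2)) ≈ G a b (j ℤ.+ (k ℤ.+ + 1)) + G a b (j ℤ.+ k)
      shifted-rec k = begin
        G a b (j ℤ.+ (k ℤ.+ + 2))                   ≡⟨ ≡.cong (G a b) (ℤP.+-assoc j k (+ 2)) ⟨
        G a b (j ℤ.+ k ℤ.+ + 2)                     ≈⟨ G-rec a b (j ℤ.+ k) ⟩
        G a b (j ℤ.+ k ℤ.+ + 1) + G a b (j ℤ.+ k)   ≡⟨ ≡.cong (λ i → G a b i + G a b (j ℤ.+ k))
                                                              (ℤP.+-assoc j k (+ 1)) ⟩
        G a b (j ℤ.+ (k ℤ.+ + 1)) + G a b (j ℤ.+ k) ∎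

    module Recentred (m : ℤ) where
      j : ℤ
      j = m ℤ.- + 3

      window : ℤ → Carrier
      window = G⁵ (G a b (j ℤ.+ + 0)) (G a b (j ℤ.+ + 1))

      ≈window : ∀ {l} d → l ≡ j ℤ.+ d → ∀ i → g (l ℤ.+ i) ≈ window (d ℤ.+ i)
      ≈window {l} d l≡j+d i = pow-cong 5 (begin
        G a b (l ℤ.+ i)           ≡⟨ ≡.cong (λ l → G a b (l ℤ.+ i)) l≡j+d ⟩
        G a b (j ℤ.+ d ℤ.+ i)     ≡⟨ ≡.cong (G a b) (ℤP.+-assoc j d i) ⟩
        G a b (j ℤ.+ (d ℤ.+ i))   ≈⟨ G-shift j (d ℤ.+ i) ⟩
        G (G a b (j ℤ.+ + 0)) (G a b (j ℤ.+ + 1)) (d ℤ.+ i) ∎)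

      at-m : ∀ i → g (m ℤ.+ i) ≈ window (+ 3 ℤ.+ i)
      at-m = ≈window (+ 3) (m≡m-3+3 m)

      at-m-1 : ∀ i → g (m ℤ.- + 1 ℤ.+ i) ≈ window (+ 2 ℤ.+ i)
      at-m-1 = ≈window (+ 2) (m-1≡m-3+2 m)

    Φ₁-step : ∀ m → Φ₁ g m ≈ Φ₁ g (m ℤ.- + 1) + nat 44 * g m
    Φ₁-step m = begin
      Φ₁ g m                                    ≈⟨ Φ₁-cong g m window (+ 3) at-m ⟩
      Φ₁ window (+ 3)                           ≈⟨ Φ₁-step-at-3 _ _ ⟩
      Φ₁ window (+ 2) + nat 44 * window (+ 3)   ≈⟨ +-cong (Φ₁-cong g (m ℤ.- + 1) window (+ 2) at-m-1)
                                                          (*-congˡ (centre-≈ g m window (+ 3) at-m)) ⟨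
      Φ₁ g (m ℤ.- + 1) + nat 44 * g m           ∎
      where open Recentred m

    Φ₂-step : ∀ m → Φ₂ g m + Φ₂ g (m ℤ.- + 1) ≈ nat 44 * g m
    Φ₂-step m = begin
      Φ₂ g m + Φ₂ g (m ℤ.- + 1)           ≈⟨ +-cong (Φ₂-cong g m window (+ 3) at-m)
                                                    (Φ₂-cong g (m ℤ.- + 1) window (+ 2) at-m-1) ⟩
      Φ₂ window (+ 3) + Φ₂ window (+ 2)   ≈⟨ Φ₂-step-at-3 _ _ ⟩
      nat 44 * window (+ 3)               ≈⟨ *-congˡ (centre-≈ g m window (+ 3) at-m) ⟨
      nat 44 * g m                        ∎
      where open Recentred m

    sum-of-fifth-powers : ∀ t n →
      nat 44 * sum1to (λ j → g (j ℤ.+ t)) n ≈ Φ₁ g (n ℤ.+ t) - Φ₁ g t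
    sum-of-fifth-powers t =
      telescope (nat 44) (λ j → g (j ℤ.+ t)) (λ n → Φ₁ g (n ℤ.+ t) - Φ₁ g t) base step
      where
      base : Φ₁ g (+ 0 ℤ.+ t) - Φ₁ g t ≈ 0#
      base = trans (+-congʳ (reflexive (≡.cong (Φ₁ g) (ℤP.+-identityˡ t)))) (-‿inverseʳ _)

      step : ∀ n → Φ₁ g (n ℤ.+ t) - Φ₁ g t
                   ≈ Φ₁ g (n ℤ.- + 1 ℤ.+ t) - Φ₁ g t + nat 44 * g (n ℤ.+ t)
      step n = begin
        Φ₁ g m - Φ₁ g t
          ≈⟨ +-congʳ (Φ₁-step m) ⟩
        Φ₁ g (m ℤ.- + 1) + nat 44 * g m - Φ₁ g t
          ≈⟨ solve 3 (λ x y z → x :+ y :- z := x :- z :+ y) refl _ _ _ ⟩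
        Φ₁ g (m ℤ.- + 1) - Φ₁ g t + nat 44 * g m
          ≡⟨ ≡.cong (λ i → Φ₁ g i - Φ₁ g t + nat 44 * g m) (n-1+t≡n+t-1 n t) ⟨
        Φ₁ g (n ℤ.- + 1 ℤ.+ t) - Φ₁ g t + nat 44 * g m ∎
        where
        m : ℤ
        m = n ℤ.+ t

    alternating-sum-of-fifth-powers : ∀ t n →
      nat 44 * sum1to (λ j → sign (j ℤ.- + 1) * g (j ℤ.+ t)) n
        ≈ sign (n ℤ.+ + 1) * Φ₂ g (n ℤ.+ t) + Φ₂ g t
    alternating-sum-of-fifth-powers t =
      telescope (nat 44) (λ j → sign (j ℤ.- + 1) * g (j ℤ.+ t))
                (λ n → sign (n ℤ.+ + 1) * Φ₂ g (n ℤ.+ t) + Φ₂ g t) base step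
      where
      base : - 1# * Φ₂ g (+ 0 ℤ.+ t) + Φ₂ g t ≈ 0#
      base = begin
        - 1# * Φ₂ g (+ 0 ℤ.+ t) + Φ₂ g t   ≡⟨ ≡.cong (λ i → - 1# * Φ₂ g i + Φ₂ g t)
                                                      (ℤP.+-identityˡ t) ⟩
        - 1# * Φ₂ g t + Φ₂ g t             ≈⟨ +-congʳ (-1*x≈-x _) ⟩
        - Φ₂ g t + Φ₂ g t                  ≈⟨ -‿inverseˡ _ ⟩
        0#                                 ∎

      step : ∀ n → sign (n ℤ.+ + 1) * Φ₂ g (n ℤ.+ t) + Φ₂ g t
                   ≈ sign (n ℤ.- + 1 ℤ.+ + 1) * Φ₂ g (n ℤ.- + 1 ℤ.+ t) + Φ₂ g t
                     + nat 44 * (sign (n ℤ.- + 1) * g (n ℤ.+ t))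
      step n = sym (begin
        sign (n ℤ.- + 1 ℤ.+ + 1) * Φ₂ g (n ℤ.- + 1 ℤ.+ t) + Φ₂ g t + nat 44 * (τ * g m)
          ≈⟨ +-cong (+-congʳ (*-cong (sign-suc (n ℤ.- + 1))
                                     (reflexive (≡.cong (Φ₂ g) (n-1+t≡n+t-1 n t)))))
                    (solve 3 (λ c τ x → c :* (τ :* x) := τ :* (c :* x)) refl _ _ _) ⟩
        - τ * Φ₂ g (m ℤ.- + 1) + Φ₂ g t + τ * (nat 44 * g m)
          ≈⟨ +-congˡ (*-congˡ (Φ₂-step m)) ⟨
        - τ * Φ₂ g (m ℤ.- + 1) + Φ₂ g t + τ * (Φ₂ g m + Φ₂ g (m ℤ.- + 1))
          ≈⟨ solve 4 (λ τ x y z → :- τ :* y :+ z :+ τ :* (x :+ y) := τ :* x :+ z) refl τ _ _ _ ⟩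
        τ * Φ₂ g m + Φ₂ g t
          ≈⟨ +-congʳ (*-congʳ (trans (reflexive (≡.cong sign (n+1≡n-1+2 n))) (sign-+2 (n ℤ.- + 1)))) ⟨
        sign (n ℤ.+ + 1) * Φ₂ g m + Φ₂ g t ∎)
        where
        m : ℤ
        m = n ℤ.+ t
        τ : Carrier
        τ = sign (n ℤ.- + 1)

proposition1 : ∀ {c ℓ : Level} (R : CommutativeRing c ℓ) →
  let open CommutativeRing R
      open Gib R
  in (a b : Carrier) → ¬ ((a ≈ 0#) × (b ≈ 0#)) → (n t : ℤ) →
  let g = λ (k : ℤ) → pow (G a b k) 5
      s = sign (n ℤ.+ + 1)
  in (nat 44 * sum1to (λ j → g (j ℤ.+ t)) n
    ≈ - (g (n ℤ.+ t ℤ.+ + 3) - g (t ℤ.+ + 3))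
    + nat 7 * (g (n ℤ.+ t ℤ.+ + 2) - g (t ℤ.+ + 2))
    + nat 47 * (g (n ℤ.+ t ℤ.+ + 1) - g (t ℤ.+ + 1))
    + nat 31 * (g (n ℤ.+ t) - g t)
    - nat 9 * (g (n ℤ.+ t ℤ.- + 1) - g (t ℤ.- + 1))
    - (g (n ℤ.+ t ℤ.- + 2) - g (t ℤ.- + 2)))
  × (nat 44 * sum1to (λ j → sign (j ℤ.- + 1) * g (j ℤ.+ t)) n
    ≈ - (s * g (n ℤ.+ t ℤ.+ + 3) + g (t ℤ.+ + 3))
    + nat 9 * (s * g (n ℤ.+ t ℤ.+ + 2) + g (t ℤ.+ + 2))
    + nat 31 * (s * g (n ℤ.+ t ℤ.+ + 1) + g (t ℤ.+ + 1))
    - nat 47 * (s * g (n ℤ.+ t) + g t)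
    + nat 7 * (s * g (n ℤ.+ t ℤ.- + 1) + g (t ℤ.- + 1))
    + (s * g (n ℤ.+ t ℤ.- + 2) + g (t ℤ.- + 2)))
proposition1 R a b _ n t =
    trans (sum-of-fifth-powers t n) (Φ₁-difference g (n ℤ.+ t) t)
  , trans (alternating-sum-of-fifth-powers t n) (Φ₂-combination g (sign (n ℤ.+ + 1)) (n ℤ.+ t) t)
  where
  open CommutativeRing R using (trans)
  open Gib R using (sign)
  open FifthPowerSums R
  open FifthPowerSums.Sequence R a b
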